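{- Let $G=(V,E)$ be a graph with $m$ edges and $T$ triangles, and let $V'\subseteq V$ with $\ell=|V'|$. Then $$\sum_{\substack{e\in E\\ e\cap V'\neq\emptyset}} t^+(e)\,t(e)\le 6(2+\log_2 m)\,\ell\, T.$$
   Context: For an edge $e$, $t(e)$ is the number of triangles of $G$ containing $e$. Edges are totally ordered by $e_1\prec e_2$ iff $t(e_1)<t(e_2)$, or $t(e_1)=t(e_2)$ and $id(e_1)\le id(e_2)$, where $id$ is a fixed injective labelling of edges. Each triangle is assigned to its $\prec$-minimal edge, and $t^+(e)$ is the number of triangles assigned to $e$. -}

module Defs where

open import Data.Bool using (Bool; true; false; _∧_; _∨_; if_then_else_)
open import Data.Nat using (ℕ; zero; suc; _+_; _*_; _∸_; _^_; _≤_; _<ᵇ_; _≡ᵇ_; _≤ᵇ_)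
open import Data.Fin using (Fin; toℕ)
open import Data.Sum using (_⊎_)
open import Data.Product using (_×_)
open import Relation.Binary.PropositionalEquality using (_≡_)

∑ : (n : ℕ) → (Fin n → ℕ) → ℕ
∑ zero    f = 0
∑ (suc n) f = f Fin.zero + ∑ n (λ i → f (Fin.suc i))

[_] : Bool → ℕ
[ true ]  = 1
[ false ] = 0

_<v_ : {n : ℕ} → Fin n → Fin n → Bool
i <v j = toℕ i <ᵇ toℕ j

record Graph (n : ℕ) : Set where
  field
    adj    : Fin n → Fin n → Bool
    sym    : ∀ u v → adj u v ≡ adj v u
    irrefl : ∀ u → adj u u ≡ false
open Graph public

module _ {n : ℕ} (G : Graph n) where

  edgeCount : ℕ
  edgeCount = ∑ n λ u → ∑ n λ v → [ (u <v v) ∧ adj G u v ]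

  triangleCount : ℕ
  triangleCount = ∑ n λ u → ∑ n λ v → ∑ n λ w →
    [ (u <v v) ∧ (v <v w) ∧ adj G u v ∧ adj G v w ∧ adj G u w ]

  tri : Fin n → Fin n → ℕ
  tri u v = ∑ n λ w → [ adj G u w ∧ adj G v w ]

  record EdgeLabelling : Set where
    field
      lab    : Fin n → Fin n → ℕ
      labSym : ∀ u v → lab u v ≡ lab v u
      labInj : ∀ u v x y → adj G u v ≡ true → adj G x y ≡ true →
               lab u v ≡ lab x y → (u ≡ x × v ≡ y) ⊎ (u ≡ y × v ≡ x)
  open EdgeLabelling public

  module _ (L : EdgeLabelling) where

    prec : Fin n → Fin n → Fin n → Fin n → Bool
    prec u v x y = (tri u v <ᵇ tri x y)
                 ∨ ((tri u v ≡ᵇ tri x y) ∧ (lab L u v ≤ᵇ lab L x y))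

    -- t⁺(e) for e = {u,v}: triangles {u,v,w} whose ≺-minimal edge is {u,v}
    triPlus : Fin n → Fin n → ℕ
    triPlus u v = ∑ n λ w →
      [ adj G u w ∧ adj G v w ∧ prec u v u w ∧ prec u v v w ]

card : {n : ℕ} → (Fin n → Bool) → ℕ
card {n} P = ∑ n λ u → [ P u ]

-- "S ≤ 6 (2 + log₂ m) c" for naturals S, m, c (m ≥ 1), written without reals:
-- equivalent to  S ≤ 12 c  or  2^(S - 12c) ≤ m^(6c).
LeSixTwoPlusLog : ℕ → ℕ → ℕ → Set
LeSixTwoPlusLog S m c = S ≤ 12 * c ⊎ 2 ^ (S ∸ 12 * c) ≤ m ^ (6 * c)

{-# OPTIONS --safe #-}
module Submission where

-- Each triangle uvw assigned to its ≺-minimal edge uv contributes t(uv) to t⁺(uv)·t(uv),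
-- and t(uv) ≤ t(vw). Hence the edges at a fixed vertex u carry total weight at most the
-- sum of t(vw) over ordered edges (v, w), which is 6T. Every edge meeting V' has an
-- endpoint in V'.

open import Defs hiding (sym)
open import Data.Bool using (Bool; true; false; _∧_; _∨_; T)
open import Data.Bool.Properties using (T-∧; T-∨)
open import Data.Empty using (⊥-elim)
open import Data.Fin using (Fin; toℕ)
open import Data.Fin.Properties using (<-cmp)
open import Data.Nat using (ℕ; zero; suc; _+_; _*_; _≤_; _<_; z≤n)
open import Data.Nat.Properties
  using (≤-refl; ≤-reflexive; ≤-trans; <⇒≤; m≤m+n; +-identityʳ; +-mono-≤; +-monoˡ-≤;
         *-comm; *-zeroʳ; *-distribˡ-+; *-monoʳ-≤; <ᵇ⇒<; <⇒<ᵇ; ≡ᵇ⇒≡; module ≤-Reasoning)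
open import Data.Nat.Tactic.RingSolver using (solve-∀)
open import Data.Product using (_×_; _,_)
open import Data.Sum using (inj₁; inj₂)
open import Function.Bundles using (Equivalence)
open import Relation.Binary.Definitions using (tri<; tri≈; tri>)
open import Relation.Binary.PropositionalEquality
  using (_≡_; refl; sym; trans; cong; cong₂; subst; module ≡-Reasoning)

∑-cong : ∀ n {f g : Fin n → ℕ} → (∀ i → f i ≡ g i) → ∑ n f ≡ ∑ n g
∑-cong zero    f≗g = refl
∑-cong (suc n) f≗g = cong₂ _+_ (f≗g Fin.zero) (∑-cong n (λ i → f≗g (Fin.suc i)))

∑-mono : ∀ n {f g : Fin n → ℕ} → (∀ i → f i ≤ g i) → ∑ n f ≤ ∑ n g
∑-mono zero    f≤g = z≤n
∑-mono (suc n) f≤g = +-mono-≤ (f≤g Fin.zero) (∑-mono n (λ i → f≤g (Fin.suc i)))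

∑-distrib-+ : ∀ n (f g : Fin n → ℕ) → ∑ n (λ i → f i + g i) ≡ ∑ n f + ∑ n g
∑-distrib-+ zero    f g = refl
∑-distrib-+ (suc n) f g = trans
  (cong (f Fin.zero + g Fin.zero +_) (∑-distrib-+ n (λ i → f (Fin.suc i)) (λ i → g (Fin.suc i))))
  (+-+-comm (f Fin.zero) (g Fin.zero) _ _)
  where
  +-+-comm : ∀ a b c d → (a + b) + (c + d) ≡ (a + c) + (b + d)
  +-+-comm = solve-∀

∑-*ˡ : ∀ n c (f : Fin n → ℕ) → ∑ n (λ i → c * f i) ≡ c * ∑ n f
∑-*ˡ zero    c f = sym (*-zeroʳ c)
∑-*ˡ (suc n) c f = trans (cong (c * f Fin.zero +_) (∑-*ˡ n c (λ i → f (Fin.suc i))))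
                         (sym (*-distribˡ-+ c (f Fin.zero) _))

∑-*ʳ : ∀ n c (f : Fin n → ℕ) → ∑ n (λ i → f i * c) ≡ ∑ n f * c
∑-*ʳ n c f = trans (∑-cong n (λ i → *-comm (f i) c)) (trans (∑-*ˡ n c f) (*-comm c _))

∑-zero : ∀ n → ∑ n (λ _ → 0) ≡ 0
∑-zero zero    = refl
∑-zero (suc n) = ∑-zero n

∑-comm : ∀ m n (f : Fin m → Fin n → ℕ) →
  ∑ m (λ i → ∑ n (f i)) ≡ ∑ n (λ j → ∑ m (λ i → f i j))
∑-comm zero    n f = sym (∑-zero n)
∑-comm (suc m) n f = trans (cong (∑ n (f Fin.zero) +_) (∑-comm m n (λ i → f (Fin.suc i))))
                           (sym (∑-distrib-+ n (f Fin.zero) _))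

∑³ : ∀ n → (Fin n → Fin n → Fin n → ℕ) → ℕ
∑³ n h = ∑ n λ a → ∑ n λ b → ∑ n λ c → h a b c

module _ {n : ℕ} where

  ∑³-swap₁₂ : ∀ h → ∑³ n (λ a b c → h b a c) ≡ ∑³ n h
  ∑³-swap₁₂ h = ∑-comm n n (λ a b → ∑ n (h b a))

  ∑³-swap₂₃ : ∀ h → ∑³ n (λ a b c → h a c b) ≡ ∑³ n h
  ∑³-swap₂₃ h = ∑-cong n (λ a → ∑-comm n n (λ b c → h a c b))

  ∑³-distrib-+ : ∀ f g → ∑³ n (λ a b c → f a b c + g a b c) ≡ ∑³ n f + ∑³ n g
  ∑³-distrib-+ f g = trans
    (∑-cong n (λ a → trans (∑-cong n (λ b → ∑-distrib-+ n _ _)) (∑-distrib-+ n _ _)))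
    (∑-distrib-+ n _ _)

  symmetrize₂₃ : (Fin n → Fin n → Fin n → ℕ) → Fin n → Fin n → Fin n → ℕ
  symmetrize₂₃ h a b c = h a b c + h a c b

  symmetrize : (Fin n → Fin n → Fin n → ℕ) → Fin n → Fin n → Fin n → ℕ
  symmetrize h a b c = symmetrize₂₃ h a b c + symmetrize₂₃ h b a c + symmetrize₂₃ h c a b

  ∑³-symmetrize : ∀ h → ∑³ n (symmetrize h) ≡ 6 * ∑³ n h
  ∑³-symmetrize h = begin
      ∑³ n (symmetrize h)
    ≡⟨ trans (∑³-distrib-+ _ _) (cong (_+ ∑³ n (λ a b c → pair c a b)) (∑³-distrib-+ _ _)) ⟩
      ∑³ n pair + ∑³ n (λ a b c → pair b a c) + ∑³ n (λ a b c → pair c a b)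
    ≡⟨ cong₂ (λ x y → ∑³ n pair + x + y)
         (∑³-swap₁₂ pair) (trans (∑³-swap₂₃ (λ a b c → pair b a c)) (∑³-swap₁₂ pair)) ⟩
      ∑³ n pair + ∑³ n pair + ∑³ n pair
    ≡⟨ cong (λ x → x + x + x) (trans (∑³-distrib-+ h _) (cong (∑³ n h +_) (∑³-swap₂₃ h))) ⟩
      (∑³ n h + ∑³ n h) + (∑³ n h + ∑³ n h) + (∑³ n h + ∑³ n h)
    ≡⟨ six-fold (∑³ n h) ⟩
      6 * ∑³ n h
    ∎
    where
    open ≡-Reasoning
    pair : Fin n → Fin n → Fin n → ℕ
    pair = symmetrize₂₃ h
    six-fold : ∀ x → (x + x) + (x + x) + (x + x) ≡ 6 * x
    six-fold = solve-∀

  symmetrize-swap₁₂ : ∀ h a b c → symmetrize h a b c ≡ symmetrize h b a c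
  symmetrize-swap₁₂ h a b c = reorder (h a b c) (h a c b) (h b a c) (h b c a) (h c a b) (h c b a)
    where
    reorder : ∀ x₁ x₂ x₃ x₄ x₅ x₆ →
      (x₁ + x₂) + (x₃ + x₄) + (x₅ + x₆) ≡ (x₃ + x₄) + (x₁ + x₂) + (x₆ + x₅)
    reorder = solve-∀

  symmetrize-swap₂₃ : ∀ h a b c → symmetrize h a b c ≡ symmetrize h a c b
  symmetrize-swap₂₃ h a b c = reorder (h a b c) (h a c b) (h b a c) (h b c a) (h c a b) (h c b a)
    where
    reorder : ∀ x₁ x₂ x₃ x₄ x₅ x₆ →
      (x₁ + x₂) + (x₃ + x₄) + (x₅ + x₆) ≡ (x₂ + x₁) + (x₅ + x₆) + (x₃ + x₄)
    reorder = solve-∀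

  ≤-symmetrize : ∀ h a b c → h a b c ≤ symmetrize h a b c
  ≤-symmetrize h a b c = ≤-trans (m≤m+n _ _) (≤-trans (m≤m+n _ _) (m≤m+n _ _))

  wlog-increasing : (P : Fin n → Fin n → Fin n → Set) →
    (∀ {a b c} → P a b c → P b a c) →
    (∀ {a b c} → P a b c → P a c b) →
    (∀ {a c} → P a a c) →
    (∀ {a b c} → toℕ a < toℕ b → toℕ b < toℕ c → P a b c) →
    ∀ a b c → P a b c
  wlog-increasing P swap₁₂ swap₂₃ diagonal increasing a b c
    with <-cmp a b | <-cmp b c
  ... | tri≈ _ refl _ | _             = diagonal
  ... | _             | tri≈ _ refl _ = swap₁₂ (swap₂₃ (swap₁₂ diagonal))
  ... | tri< a<b _ _  | tri< b<c _ _  = increasing a<b b<c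
  ... | tri> _ _ b<a  | tri> _ _ c<b  = swap₁₂ (swap₂₃ (swap₁₂ (increasing c<b b<a)))
  ... | tri< a<b _ _  | tri> _ _ c<b  with <-cmp a c
  ...   | tri< a<c _ _ = swap₂₃ (increasing a<c c<b)
  ...   | tri≈ _ refl _ = swap₂₃ diagonal
  ...   | tri> _ _ c<a = swap₂₃ (swap₁₂ (increasing c<a a<b))
  wlog-increasing P swap₁₂ swap₂₃ diagonal increasing a b c
      | tri> _ _ b<a  | tri< b<c _ _  with <-cmp a c
  ...   | tri< a<c _ _ = swap₁₂ (increasing b<a a<c)
  ...   | tri≈ _ refl _ = swap₂₃ diagonal
  ...   | tri> _ _ c<a = swap₁₂ (swap₂₃ (increasing b<c c<a))

T⇒1≤[] : ∀ {x} → T x → 1 ≤ [ x ]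
T⇒1≤[] {true} _ = ≤-refl

[]*≤ : ∀ b x → [ b ] * x ≤ x
[]*≤ true  x = ≤-reflexive (+-identityʳ x)
[]*≤ false x = z≤n

[]*[]≤ : ∀ x y {z} → (T x → T y → 1 ≤ z) → [ x ] * [ y ] ≤ z
[]*[]≤ false y     _ = z≤n
[]*[]≤ true  false _ = z≤n
[]*[]≤ true  true  h = h _ _

[]*-mono : ∀ {a b} x y → (T a → T b × x ≤ y) → [ a ] * x ≤ [ b ] * y
[]*-mono {false}         x y h = z≤n
[]*-mono {true} {false}  x y h with h _
... | () , _
[]*-mono {true} {true}   x y h with h _
... | _ , x≤y = +-monoˡ-≤ 0 x≤y

[∧∧∨]*≤ : ∀ a b c d x → [ a ∧ b ∧ (c ∨ d) ] * x ≤ [ c ] * ([ b ] * x) + [ d ] * ([ b ] * x)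
[∧∧∨]*≤ false b     c     d     x = z≤n
[∧∧∨]*≤ true  false c     d     x = z≤n
[∧∧∨]*≤ true  true  true  d     x = ≤-trans (m≤m+n (x + 0) 0) (m≤m+n _ _)
[∧∧∨]*≤ true  true  false true  x = m≤m+n (x + 0) 0
[∧∧∨]*≤ true  true  false false x = z≤n

∑-[]*≤card* : ∀ {n} (P : Fin n → Bool) (f : Fin n → ℕ) {M} → (∀ i → f i ≤ M) →
  ∑ n (λ i → [ P i ] * f i) ≤ card P * M
∑-[]*≤card* {n} P f {M} f≤M = begin
  ∑ n (λ i → [ P i ] * f i) ≤⟨ ∑-mono n (λ i → *-monoʳ-≤ [ P i ] (f≤M i)) ⟩
  ∑ n (λ i → [ P i ] * M)   ≡⟨ ∑-*ʳ n M (λ i → [ P i ]) ⟩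
  card P * M                ∎
  where open ≤-Reasoning

prec⇒tri≤ : ∀ {n} (G : Graph n) (L : EdgeLabelling G) {u v x y} →
  T (prec G L u v x y) → tri G u v ≤ tri G x y
prec⇒tri≤ G L {u} {v} {x} {y} h with Equivalence.to T-∨ h
... | inj₁ lt       = <⇒≤ (<ᵇ⇒< _ _ lt)
... | inj₂ eq∧lab≤ with Equivalence.to T-∧ eq∧lab≤
...   | eq , _ = ≤-reflexive (≡ᵇ⇒≡ _ _ eq)

T-∧-intro : ∀ {x y} → T x → T y → T (x ∧ y)
T-∧-intro p q = Equivalence.from T-∧ (p , q)

module _ {n : ℕ} (G : Graph n) where

  Triangle : Fin n → Fin n → Fin n → Set
  Triangle a b c = T (adj G a b) × T (adj G a c) × T (adj G b c)

  T-adj-sym : ∀ {a b} → T (adj G a b) → T (adj G b a)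
  T-adj-sym {a} {b} = subst T (Graph.sym G a b)

  increasingTriangle : Fin n → Fin n → Fin n → ℕ
  increasingTriangle a b c = [ (a <v b) ∧ (b <v c) ∧ adj G a b ∧ adj G b c ∧ adj G a c ]

  Triangle⇒1≤symmetrize : ∀ a b c → Triangle a b c → 1 ≤ symmetrize increasingTriangle a b c
  Triangle⇒1≤symmetrize = wlog-increasing P swap₁₂ swap₂₃ diagonal increasing
    where
    P : Fin n → Fin n → Fin n → Set
    P a b c = Triangle a b c → 1 ≤ symmetrize increasingTriangle a b c
    swap₁₂ : ∀ {a b c} → P a b c → P b a c
    swap₁₂ {a} {b} {c} p (ba , bc , ac) =
      subst (1 ≤_) (symmetrize-swap₁₂ increasingTriangle a b c) (p (T-adj-sym ba , ac , bc))
    swap₂₃ : ∀ {a b c} → P a b c → P a c b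
    swap₂₃ {a} {b} {c} p (ac , ab , cb) =
      subst (1 ≤_) (symmetrize-swap₂₃ increasingTriangle a b c) (p (ab , ac , T-adj-sym cb))
    diagonal : ∀ {a c} → P a a c
    diagonal {a} (aa , _ , _) = ⊥-elim (subst T (irrefl G a) aa)
    increasing : ∀ {a b c} → toℕ a < toℕ b → toℕ b < toℕ c → P a b c
    increasing {a} {b} {c} a<b b<c (ab , ac , bc) = ≤-trans
      (T⇒1≤[] (T-∧-intro (<⇒<ᵇ a<b) (T-∧-intro (<⇒<ᵇ b<c) (T-∧-intro ab (T-∧-intro bc ac)))))
      (≤-symmetrize increasingTriangle a b c)

  orderedEdgeTriangles : ℕ
  orderedEdgeTriangles = ∑ n λ a → ∑ n λ b → [ adj G a b ] * tri G a b

  orderedEdgeTriangles≤6T : orderedEdgeTriangles ≤ 6 * triangleCount G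
  orderedEdgeTriangles≤6T = begin
    orderedEdgeTriangles
      ≡⟨ ∑-cong n (λ a → ∑-cong n (λ b → sym (∑-*ˡ n [ adj G a b ] _))) ⟩
    ∑³ n (λ a b c → [ adj G a b ] * [ adj G a c ∧ adj G b c ])
      ≤⟨ ∑-mono n (λ a → ∑-mono n (λ b → ∑-mono n (λ c → triangle≤ a b c))) ⟩
    ∑³ n (symmetrize increasingTriangle)
      ≡⟨ ∑³-symmetrize increasingTriangle ⟩
    6 * triangleCount G
      ∎
    where
    open ≤-Reasoning
    triangle≤ : ∀ a b c → [ adj G a b ] * [ adj G a c ∧ adj G b c ] ≤ symmetrize increasingTriangle a b c
    triangle≤ a b c = []*[]≤ (adj G a b) (adj G a c ∧ adj G b c) λ ab ac∧bc →
      let ac , bc = Equivalence.to T-∧ ac∧bc in Triangle⇒1≤symmetrize a b c (ab , ac , bc)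

  module _ (L : EdgeLabelling G) where

    assigned : Fin n → Fin n → Fin n → Bool
    assigned u v w = adj G u w ∧ adj G v w ∧ prec G L u v u w ∧ prec G L u v v w

    assigned-parts : ∀ {u v w} → T (assigned u v w) →
      T (adj G u w) × T (adj G v w) × T (prec G L u v u w) × T (prec G L u v v w)
    assigned-parts a with Equivalence.to T-∧ a
    ... | uw , a′ with Equivalence.to T-∧ a′
    ...   | vw , a″ = uw , vw , Equivalence.to T-∧ a″

    weight : Fin n → Fin n → ℕ
    weight u v = triPlus G L u v * tri G u v

    weight≡∑assigned : ∀ u v → weight u v ≡ ∑ n (λ w → [ assigned u v w ] * tri G u v)
    weight≡∑assigned u v = sym (∑-*ʳ n (tri G u v) (λ w → [ assigned u v w ]))

    weight≤∑tri-at-endpoint₂ : ∀ u v → weight u v ≤ ∑ n (λ w → [ adj G v w ] * tri G v w)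
    weight≤∑tri-at-endpoint₂ u v = ≤-trans (≤-reflexive (weight≡∑assigned u v))
      (∑-mono n λ w → []*-mono _ _ λ a →
        let _ , vw , _ , uv≼vw = assigned-parts a in vw , prec⇒tri≤ G L uv≼vw)

    weight≤∑tri-at-endpoint₁ : ∀ u v → weight u v ≤ ∑ n (λ w → [ adj G u w ] * tri G u w)
    weight≤∑tri-at-endpoint₁ u v = ≤-trans (≤-reflexive (weight≡∑assigned u v))
      (∑-mono n λ w → []*-mono _ _ λ a →
        let uw , _ , uv≼uw , _ = assigned-parts a in uw , prec⇒tri≤ G L uv≼uw)

    ∑-weight-at-source≤ : ∀ u → ∑ n (λ v → [ adj G u v ] * weight u v) ≤ orderedEdgeTriangles
    ∑-weight-at-source≤ u = ∑-mono n λ v → ≤-trans ([]*≤ (adj G u v) _) (weight≤∑tri-at-endpoint₂ u v)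

    ∑-weight-at-target≤ : ∀ v → ∑ n (λ u → [ adj G u v ] * weight u v) ≤ orderedEdgeTriangles
    ∑-weight-at-target≤ v = ∑-mono n λ u → ≤-trans ([]*≤ (adj G u v) _) (weight≤∑tri-at-endpoint₁ u v)

    ∑-weight-touching≤12ℓT : (V' : Fin n → Bool) →
      (∑ n λ u → ∑ n λ v → [ (u <v v) ∧ adj G u v ∧ (V' u ∨ V' v) ] * weight u v)
        ≤ 12 * (card V' * triangleCount G)
    ∑-weight-touching≤12ℓT V' = begin
      (∑ n λ u → ∑ n λ v → [ (u <v v) ∧ adj G u v ∧ (V' u ∨ V' v) ] * weight u v)
        ≤⟨ ∑-mono n (λ u → ∑-mono n (λ v →
             [∧∧∨]*≤ (u <v v) (adj G u v) (V' u) (V' v) (weight u v))) ⟩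
      (∑ n λ u → ∑ n λ v → at-source u v + at-target u v)
        ≡⟨ trans (∑-cong n (λ u → ∑-distrib-+ n _ _)) (∑-distrib-+ n _ _) ⟩
      (∑ n λ u → ∑ n (at-source u)) + (∑ n λ u → ∑ n λ v → at-target u v)
        ≡⟨ cong₂ _+_ (∑-cong n (λ u → ∑-*ˡ n [ V' u ] _))
                     (trans (∑-comm n n at-target) (∑-cong n (λ v → ∑-*ˡ n [ V' v ] _))) ⟩
      (∑ n λ u → [ V' u ] * ∑ n (λ v → [ adj G u v ] * weight u v))
        + (∑ n λ v → [ V' v ] * ∑ n (λ u → [ adj G u v ] * weight u v))
        ≤⟨ +-mono-≤ (∑-[]*≤card* V' _ ∑-weight-at-source≤) (∑-[]*≤card* V' _ ∑-weight-at-target≤) ⟩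
      card V' * orderedEdgeTriangles + card V' * orderedEdgeTriangles
        ≤⟨ +-mono-≤ (*-monoʳ-≤ (card V') orderedEdgeTriangles≤6T)
                    (*-monoʳ-≤ (card V') orderedEdgeTriangles≤6T) ⟩
      card V' * (6 * triangleCount G) + card V' * (6 * triangleCount G)
        ≡⟨ twice-six (card V') (triangleCount G) ⟩
      12 * (card V' * triangleCount G)
        ∎
      where
      open ≤-Reasoning
      at-source at-target : Fin n → Fin n → ℕ
      at-source u v = [ V' u ] * ([ adj G u v ] * weight u v)
      at-target u v = [ V' v ] * ([ adj G u v ] * weight u v)
      twice-six : ∀ ℓ t → ℓ * (6 * t) + ℓ * (6 * t) ≡ 12 * (ℓ * t)
      twice-six = solve-∀

mainTheorem12 : (n : ℕ) (G : Graph n) (L : EdgeLabelling G) (V' : Fin n → Bool) →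
    LeSixTwoPlusLog
      (∑ n λ u → ∑ n λ v →
         [ (u <v v) ∧ adj G u v ∧ (V' u ∨ V' v) ] * (triPlus G L u v * tri G u v))
      (edgeCount G)
      (card V' * triangleCount G)
mainTheorem12 n G L V' = inj₁ (∑-weight-touching≤12ℓT G L V')
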